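{- Let $k\in\mathbb{N}$, let $\mathbb{A}$ be a relational structure on the set $A$ and $\mathbb{B}$ a relational structure on the set $A^k$. Let $I=(V,\mathcal{C})$ be an instance of $\mathrm{CSP}(\mathbb{A})$, let $S_1,\dots,S_m$ be basic relations of $\mathbb{B}$, let $\sigma_1,\dots,\sigma_m$ be tuples of elements of $V^k$ (with $|\sigma_i|$ equal to the arity of $S_i$), and let $r,s$ be positive integers such that (1) $\mathcal{S}^r_{\mathbb{A}}(I)\vdash\overline{S_i}(\overline{\sigma_i})$ for each $i=1,\dots,m$, and (2) $\mathcal{S}^s_{\mathbb{B}}(J)\vdash G$, where $J$ is the instance $J=(V^k,\{(\sigma_i,S_i): i=1,\dots,m\})$ of $\mathrm{CSP}(\mathbb{B})$. Then $\mathcal{S}^{r+ks}_{\mathbb{A}}(I)\vdash G$.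
   Context: A relational structure $\mathbb{A}=(A,\mathcal{R})$ is a finite set $A$ with finitely many basic relations of positive finite arity. An instance $I=(V,\mathcal{C})$ of $\mathrm{CSP}(\mathbb{A})$ is a finite set $V$ of variables and constraints $(\sigma,R)$ with $R$ an $n$-ary basic relation and $\sigma\in V^n$. The $r$-ary maximal symmetric Datalog program $\mathcal{S}^r_{\mathbb{A}}$: IDB predicates are all relations on $A$ of arity at most $r$, plus a non-IDB symbol for each basic relation of $\mathbb{A}$ of arity at most $r$. Rules $R(\rho)\leftarrow S_1(\sigma_1),\dots,S_\ell(\sigma_\ell)$ are all rules that (1) have an IDB on the left and at most one IDB on the right, (2) use only variables from $\{x_1,\dots,x_r\}$, (3) have no repeated atom on the right, (4) are consistent with $\mathbb{A}$: for every $f\colon\{x_1,\dots,x_r\}\to A$, if $f(\sigma_i)\in S_i$ for all $i$ then $f(\rho)\in R$, and (5) if the right side contains an IDB atom, the rule with the left atom and that right IDB atom exchanged is also consistent. Goal predicates: empty relations of arity at most $r$. Derivation: $\mathcal{S}^r_{\mathbb{A}}(I)\vdash R(\rho)$ if $(\rho,R)\in\mathcal C$, or there is a rule $R(\tau)\leftarrow S_1(\sigma_1),\dots,S_\ell(\sigma_\ell)$ and a map $\omega$ from program variables to $V$ with $\omega(\tau)=\rho$ and $\mathcal{S}^r_{\mathbb{A}}(I)\vdash S_i(\omega(\sigma_i))$ for all $i$; $\vdash G$ means some goal predicate is derived on some tuple. Unpacking: for an $\ell$-tuple $\sigma=((s_{1,1},\dots,s_{1,k}),\dots,(s_{\ell,1},\dots,s_{\ell,k}))$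 of $k$-tuples, $\overline{\sigma}=(s_{1,1},\dots,s_{1,k},\dots,s_{\ell,1},\dots,s_{\ell,k})$ is the $k\ell$-tuple obtained by concatenation; for $U\subseteq (A^k)^\ell$, $\overline U=\{\overline\sigma:\sigma\in U\}\subseteq A^{k\ell}$. -}

module Defs where

open import Data.Nat using (ℕ; zero; suc; _+_; _*_; _≤_)
open import Data.Fin using (Fin)
open import Data.Vec using (Vec; map; concat)
open import Data.List using (List)
open import Data.List.Relation.Unary.All using (All)
open import Data.List.Relation.Unary.Unique.Propositional using (Unique)
open import Data.List.Membership.Propositional using (_∈_)
open import Data.Maybe using (Maybe; just; nothing)
open import Data.Product using (Σ; Σ-syntax; ∃; _×_; _,_; proj₁; proj₂)
open import Data.Unit using (⊤)
open import Relation.Nullary using (¬_)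
open import Relation.Binary.PropositionalEquality using (_≡_)
open import Function.Bundles using (_↔_)

Finite : Set → Set
Finite X = Σ ℕ λ n → X ↔ Fin n

record Structure (A : Set) : Set₁ where
  field
    numRels : ℕ
    arity   : Fin numRels → ℕ
    arity-pos : (j : Fin numRels) → 1 ≤ arity j
    rel     : (j : Fin numRels) → Vec A (arity j) → Set

open Structure public

Constraint : {A : Set} → Structure A → Set → Set
Constraint 𝔸 V = Σ[ j ∈ Fin (numRels 𝔸) ] Vec V (arity 𝔸 j)

-- Unpacking of a relation on A^k of arity l to a relation on A of arity l*k.
unpack : {A : Set} {k l : ℕ} → (Vec (Vec A k) l → Set) → Vec A (l * k) → Set
unpack {A} {k} {l} U t = Σ[ u ∈ Vec (Vec A k) l ] (concat u ≡ t × U u)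

-- The r-ary maximal symmetric Datalog program of 𝔸, run on the instance
-- with variables V and constraint list C.  Program variables x₁..x_r are Fin r.
module Symmetric {A : Set} (𝔸 : Structure A) (r : ℕ) where

  record IDBAtom : Set₁ where
    constructor idb
    field
      n     : ℕ
      n≤r   : n ≤ r
      R     : Vec A n → Set
      tuple : Vec (Fin r) n
  open IDBAtom public

  -- Atom with a non-IDB symbol (a basic relation of 𝔸); its arity must be ≤ r
  -- (required in the rule).
  EDBAtom : Set
  EDBAtom = Σ[ j ∈ Fin (numRels 𝔸) ] Vec (Fin r) (arity 𝔸 j)

  holdsIDB : (Fin r → A) → IDBAtom → Set
  holdsIDB f a = R a (map f (tuple a))

  holdsEDB : (Fin r → A) → EDBAtom → Set
  holdsEDB f e = rel 𝔸 (proj₁ e) (map f (proj₂ e))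

  holdsBody : (Fin r → A) → Maybe IDBAtom → Set
  holdsBody f nothing  = ⊤
  holdsBody f (just a) = holdsIDB f a

  Consistent : IDBAtom → List EDBAtom → Maybe IDBAtom → Set
  Consistent h es mb =
    (f : Fin r → A) → All (holdsEDB f) es → holdsBody f mb → holdsIDB f h

  record Rule : Set₁ where
    field
      head    : IDBAtom
      edbs    : List EDBAtom
      bodyIDB : Maybe IDBAtom
      edbs-small  : All (λ e → arity 𝔸 (proj₁ e) ≤ r) edbs
      edbs-unique : Unique edbs
      consistent  : Consistent head edbs bodyIDB
      symmetric   : (a : IDBAtom) → bodyIDB ≡ just a →
                    Consistent a edbs (just head)
  open Rule public

  module Run {V : Set} (C : List (Constraint 𝔸 V)) where

    EDBDerived : (Fin r → V) → EDBAtom → Set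
    EDBDerived ω e = (proj₁ e , map ω (proj₂ e)) ∈ C

    data Derives : {n : ℕ} → (Vec A n → Set) → Vec V n → Set₁ where
      by₀ : (rl : Rule) (ω : Fin r → V) →
            bodyIDB rl ≡ nothing →
            All (EDBDerived ω) (edbs rl) →
            Derives (R (head rl)) (map ω (tuple (head rl)))
      by₁ : (rl : Rule) (ω : Fin r → V) (a : IDBAtom) →
            bodyIDB rl ≡ just a →
            All (EDBDerived ω) (edbs rl) →
            Derives (R a) (map ω (tuple a)) →
            Derives (R (head rl)) (map ω (tuple (head rl)))

    DerivesGoal : Set₁
    DerivesGoal = Σ[ n ∈ ℕ ] Σ[ G ∈ (Vec A n → Set) ] Σ[ ρ ∈ Vec V n ]
                  (n ≤ r × (∀ t → ¬ G t) × Derives G ρ)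

Derivable : {A : Set} (𝔸 : Structure A) {V : Set} → List (Constraint 𝔸 V) → ℕ →
         {n : ℕ} → (Vec A n → Set) → Vec V n → Set₁
Derivable 𝔸 C r R ρ = Symmetric.Run.Derives 𝔸 r C R ρ

GoalDerived : {A : Set} (𝔸 : Structure A) {V : Set} → List (Constraint 𝔸 V) → ℕ → Set₁
GoalDerived 𝔸 C r = Symmetric.Run.DerivesGoal 𝔸 r C

module Submission where

-- Let N = s·k + r.  The first s·k program variables of S^N_𝔸 form a
-- "context": read in blocks of k, they encode an assignment of the s
-- program variables of S^s_𝔹 to elements of V^k.  The last r variables
-- are a scratch area in which derivations of S^r_𝔸 are replayed.
--
-- A rule of 𝔹 is
--    fired by loading its body into the context, adding its basic atoms
--    one at a time (each via hypothesis (1) and context extension),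
--    switching body for head, and removing the atoms again.
--  * lemma11: the unpacking of the derived empty goal is an empty relation
--    of arity ≤ N, and N = r + k·s.

open import Defs
open import Data.Nat using (ℕ; _+_; _*_; _≤_; zero; suc)
open import Data.Nat.Properties using (m≤m+n; m≤n+m; +-monoʳ-≤; *-monoˡ-≤; ≤-trans; +-comm; *-comm)
open import Data.Fin using (Fin; _↑ˡ_; _↑ʳ_; splitAt; combine; fromℕ<)
open import Data.Fin.Properties using (splitAt-↑ˡ; splitAt-↑ʳ; ↑ʳ-injective)
import Data.Vec
open import Data.Vec using (Vec; []; _∷_; _++_; concat; map; tabulate; lookup)
open import Data.Vec.Properties using (map-++; map-cong; map-∘; map-concat; lookup-map; lookup-concat; lookup∘tabulate; tabulate∘lookup; tabulate-∘; tabulate-cong; ∷-injective; ++-injective)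
open import Data.List using (List)
import Data.List as List
open import Data.List.Membership.Propositional using (_∈_)
open import Data.List.Relation.Unary.All as All using (All; []; _∷_)
open import Data.List.Relation.Unary.All.Properties using () renaming (map⁺ to All-map⁺; map⁻ to All-map⁻)
open import Data.List.Relation.Unary.Any using (here)
open import Data.List.Relation.Unary.Unique.Propositional using (Unique)
open import Data.List.Relation.Unary.Unique.Propositional.Properties using () renaming (map⁺ to Unique-map⁺)
open import Data.List.Relation.Unary.AllPairs using () renaming ([] to []ᵘ)
open import Data.Maybe using (Maybe; just; nothing)
open import Data.Product using (Σ-syntax; _×_; _,_; proj₁; proj₂)
open import Data.Product.Properties using (Σ-≡,≡←≡)
open import Data.Sum using ([_,_]′)
open import Data.Unit using (⊤; tt)
open import Data.Empty using (⊥-elim)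
open import Relation.Nullary using (¬_)
open import Relation.Binary.PropositionalEquality using (_≡_; refl; sym; trans; cong; cong₂; subst; module ≡-Reasoning)
open import Function using (_∘_)

map-injective : {X Y : Set} {f : X → Y} → (∀ {x y} → f x ≡ f y → x ≡ y) →
                {n : ℕ} (xs ys : Vec X n) → map f xs ≡ map f ys → xs ≡ ys
map-injective f-inj []       []       eq = refl
map-injective f-inj (x ∷ xs) (y ∷ ys) eq with ∷-injective eq
... | fx≡fy , eqs = cong₂ _∷_ (f-inj fx≡fy) (map-injective f-inj xs ys eqs)

concat-injective : {X : Set} {k l : ℕ} (u u′ : Vec (Vec X k) l) → concat u ≡ concat u′ → u ≡ u′
concat-injective []      []        eq = refl
concat-injective (x ∷ u) (x′ ∷ u′) eq with ++-injective x x′ eq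
... | x≡x′ , eqs = cong₂ _∷_ x≡x′ (concat-injective u u′ eqs)

unpack-concat : {X : Set} {k l : ℕ} {H : Vec (Vec X k) l → Set} (u : Vec (Vec X k) l) →
                unpack H (concat u) → H u
unpack-concat {H = H} u (u′ , eq , h) = subst H (concat-injective u′ u eq) h

_⊗_ : {X : Set} {m n : ℕ} → (Vec X m → Set) → (Vec X n → Set) → Vec X (m + n) → Set
(P ⊗ Q) w = Σ[ xs ∈ _ ] Σ[ ys ∈ _ ] (xs ++ ys ≡ w × P xs × Q ys)

⊗-split : {X : Set} {m n : ℕ} {P : Vec X m → Set} {Q : Vec X n → Set} (xs : Vec X m) (ys : Vec X n) →
          (P ⊗ Q) (xs ++ ys) → P xs × Q ys
⊗-split xs ys (xs′ , ys′ , eq , p , q) with ++-injective xs′ xs eq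
... | refl , refl = p , q

⊗-join : {X : Set} {m n : ℕ} {P : Vec X m → Set} {Q : Vec X n → Set} {xs : Vec X m} {ys : Vec X n} →
         P xs → Q ys → (P ⊗ Q) (xs ++ ys)
⊗-join p q = _ , _ , refl , p , q

module Facts {A : Set} (𝔸 : Structure A) (r : ℕ) {V : Set} (C : List (Constraint 𝔸 V)) where
  open Symmetric 𝔸 r
  open Run C

  valuation : {n : ℕ} {S : Vec A n → Set} {ρ : Vec V n} → Derives S ρ → Fin r → V
  valuation (by₀ _ ω _ _)     = ω
  valuation (by₁ _ ω _ _ _ _) = ω

  arity-bound : {n : ℕ} {S : Vec A n → Set} {ρ : Vec V n} → Derives S ρ → n ≤ r
  arity-bound (by₀ rl _ _ _)     = n≤r (head rl)
  arity-bound (by₁ rl _ _ _ _ _) = n≤r (head rl)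

  Solution : (V → A) → Set
  Solution h = ∀ {c} → c ∈ C → rel 𝔸 (proj₁ c) (map h (proj₂ c))

  basics-hold : {h : V → A} → Solution h → (ω : Fin r → V) {es : List EDBAtom} →
                All (EDBDerived ω) es → All (holdsEDB (h ∘ ω)) es
  basics-hold {h} hom ω =
    All.map λ {e} p → subst (rel 𝔸 (proj₁ e)) (sym (map-∘ h ω (proj₂ e))) (hom p)

  sound : {h : V → A} → Solution h →
          {n : ℕ} {S : Vec A n → Set} {ρ : Vec V n} → Derives S ρ → S (map h ρ)
  sound {h} hom (by₀ rl ω eq ed) =
    subst (R (head rl)) (map-∘ h ω _)
      (consistent rl (h ∘ ω) (basics-hold hom ω ed) (subst (holdsBody (h ∘ ω)) (sym eq) tt))
  sound {h} hom (by₁ rl ω a eq ed d) =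
    subst (R (head rl)) (map-∘ h ω _)
      (consistent rl (h ∘ ω) (basics-hold hom ω ed)
        (subst (holdsBody (h ∘ ω)) (sym eq) (subst (R a) (sym (map-∘ h ω _)) (sound hom d))))

  recover-body : (rl : Rule) (f : Fin r → A) → All (holdsEDB f) (edbs rl) →
                 holdsIDB f (head rl) → holdsBody f (bodyIDB rl)
  recover-body rl f es hh with bodyIDB rl in eq
  ... | nothing = tt
  ... | just a  = symmetric rl a eq f es hh

  -- A link between IDB atoms h and b: a rule h ← es, b that is consistent in
  -- both directions, so that derivations can be transported either way.
  record Link (h b : IDBAtom) : Set₁ where
    field
      basics   : List EDBAtom
      small    : All (λ e → arity 𝔸 (proj₁ e) ≤ r) basics
      unique   : Unique basics
      forward  : Consistent h basics (just b)
      backward : Consistent b basics (just h)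
  open Link public

  reverse : {h b : IDBAtom} → Link h b → Link b h
  reverse L = record { basics = basics L ; small = small L ; unique = unique L
                     ; forward = backward L ; backward = forward L }

  equivalence : (h b : IDBAtom) → (∀ f → holdsIDB f b → holdsIDB f h) →
                (∀ f → holdsIDB f h → holdsIDB f b) → Link h b
  equivalence h b b⇒h h⇒b = record { basics = List.[] ; small = [] ; unique = []ᵘ
                                   ; forward = λ f _ → b⇒h f ; backward = λ f _ → h⇒b f }

  follow : {h b : IDBAtom} (L : Link h b) (ω : Fin r → V) → All (EDBDerived ω) (basics L) →
           {ρb : Vec V (n b)} {ρh : Vec V (n h)} → map ω (tuple b) ≡ ρb → map ω (tuple h) ≡ ρh →
           Derives (R b) ρb → Derives (R h) ρh
  follow {h} {b} L ω ed refl refl d = by₁ rule ω b refl ed d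
    where
      rule : Rule
      rule = record { head = h ; edbs = basics L ; bodyIDB = just b ; edbs-small = small L
                    ; edbs-unique = unique L ; consistent = forward L
                    ; symmetric = λ { _ refl → backward L } }

  axiom : (h : IDBAtom) → (∀ f → holdsIDB f h) → (ω : Fin r → V) {ρ : Vec V (n h)} →
          map ω (tuple h) ≡ ρ → Derives (R h) ρ
  axiom h valid ω refl = by₀ rule ω refl []
    where
      rule : Rule
      rule = record { head = h ; edbs = List.[] ; bodyIDB = nothing ; edbs-small = []
                    ; edbs-unique = []ᵘ ; consistent = λ f _ _ → valid f ; symmetric = λ _ () }

module Context {A : Set} (𝔸 : Structure A) (r : ℕ) {V : Set} (C : List (Constraint 𝔸 V)) (m : ℕ) where

  N : ℕ
  N = m + r

  module SA = Symmetric 𝔸 r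
  module RA = SA.Run C
  open Symmetric 𝔸 N
  open Run C
  open Facts 𝔸 N C public hiding (recover-body)
  open Facts 𝔸 r C using (recover-body)

  ctx : Vec (Fin N) m
  ctx = tabulate (_↑ˡ r)

  shift : Fin r → Fin N
  shift = m ↑ʳ_

  ctxAtom : (Vec A m → Set) → IDBAtom
  ctxAtom P = idb m (m≤m+n m r) P ctx

  ctxPair : (P : Vec A m → Set) {l : ℕ} (Q : Vec A l → Set) → l ≤ r → Vec (Fin N) l → IDBAtom
  ctxPair P Q l≤r τ = idb (m + _) (+-monoʳ-≤ m l≤r) (P ⊗ Q) (ctx ++ τ)

  ctxPair-split : (f : Fin N → A) (P : Vec A m → Set) {l : ℕ} (Q : Vec A l → Set) (l≤r : l ≤ r)
                  (τ : Vec (Fin N) l) → holdsIDB f (ctxPair P Q l≤r τ) → P (map f ctx) × Q (map f τ)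
  ctxPair-split f P Q l≤r τ hp = ⊗-split (map f ctx) (map f τ) (subst (P ⊗ Q) (map-++ f ctx τ) hp)

  ctxPair-join : (f : Fin N → A) (P : Vec A m → Set) {l : ℕ} (Q : Vec A l → Set) (l≤r : l ≤ r)
                 (τ : Vec (Fin N) l) → P (map f ctx) → Q (map f τ) → holdsIDB f (ctxPair P Q l≤r τ)
  ctxPair-join f P Q l≤r τ p q = subst (P ⊗ Q) (sym (map-++ f ctx τ)) (⊗-join p q)

  glue : Vec V m → (Fin r → V) → Fin N → V
  glue γ w = [ lookup γ , w ]′ ∘ splitAt m

  glue-ctx : (γ : Vec V m) (w : Fin r → V) → map (glue γ w) ctx ≡ γ
  glue-ctx γ w = begin
    map (glue γ w) ctx                 ≡⟨ tabulate-∘ (glue γ w) (_↑ˡ r) ⟨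
    tabulate (glue γ w ∘ (_↑ˡ r))      ≡⟨ tabulate-cong (λ i → cong [ lookup γ , w ]′ (splitAt-↑ˡ m i r)) ⟩
    tabulate (lookup γ)                ≡⟨ tabulate∘lookup γ ⟩
    γ                                  ∎
    where open ≡-Reasoning

  glue-shift : (γ : Vec V m) (w : Fin r → V) {l : ℕ} (t : Vec (Fin r) l) →
               map (glue γ w) (map shift t) ≡ map w t
  glue-shift γ w t = begin
    map (glue γ w) (map shift t)   ≡⟨ map-∘ (glue γ w) shift t ⟨
    map (glue γ w ∘ shift) t       ≡⟨ map-cong (λ i → cong [ lookup γ , w ]′ (splitAt-↑ʳ m r i)) t ⟩
    map w t                        ∎
    where open ≡-Reasoning

  pairAtom : (P : Vec A m → Set) → SA.IDBAtom → IDBAtom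
  pairAtom P a = ctxPair P (SA.R a) (SA.n≤r a) (map shift (SA.tuple a))

  pairAtom-at : (P : Vec A m → Set) (a : SA.IDBAtom) (γ : Vec V m) (w : Fin r → V) →
                map (glue γ w) (tuple (pairAtom P a)) ≡ γ ++ map w (SA.tuple a)
  pairAtom-at P a γ w =
    trans (map-++ (glue γ w) ctx _) (cong₂ _++_ (glue-ctx γ w) (glue-shift γ w (SA.tuple a)))

  pairAtom-split : (f : Fin N → A) (P : Vec A m → Set) (a : SA.IDBAtom) →
                   holdsIDB f (pairAtom P a) → P (map f ctx) × SA.holdsIDB (f ∘ shift) a
  pairAtom-split f P a hp with ctxPair-split f P (SA.R a) (SA.n≤r a) _ hp
  ... | p , q = p , subst (SA.R a) (sym (map-∘ f shift (SA.tuple a))) q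

  pairAtom-join : (f : Fin N → A) (P : Vec A m → Set) (a : SA.IDBAtom) →
                  P (map f ctx) → SA.holdsIDB (f ∘ shift) a → holdsIDB f (pairAtom P a)
  pairAtom-join f P a p q =
    ctxPair-join f P (SA.R a) (SA.n≤r a) _ p (subst (SA.R a) (map-∘ f shift (SA.tuple a)) q)

  bodyAtom : (P : Vec A m → Set) → Maybe SA.IDBAtom → IDBAtom
  bodyAtom P nothing  = ctxAtom P
  bodyAtom P (just a) = pairAtom P a

  bodyAtom-split : (f : Fin N → A) (P : Vec A m → Set) (mb : Maybe SA.IDBAtom) →
                   holdsIDB f (bodyAtom P mb) → P (map f ctx) × SA.holdsBody (f ∘ shift) mb
  bodyAtom-split f P nothing  hp = hp , tt
  bodyAtom-split f P (just a) hp = pairAtom-split f P a hp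

  bodyAtom-join : (f : Fin N → A) (P : Vec A m → Set) (mb : Maybe SA.IDBAtom) →
                  P (map f ctx) → SA.holdsBody (f ∘ shift) mb → holdsIDB f (bodyAtom P mb)
  bodyAtom-join f P nothing  p _ = p
  bodyAtom-join f P (just a) p q = pairAtom-join f P a p q

  shiftEDB : SA.EDBAtom → EDBAtom
  shiftEDB (j , t) = j , map shift t

  shiftEDB-injective : ∀ {e e′} → shiftEDB e ≡ shiftEDB e′ → e ≡ e′
  shiftEDB-injective {j , t} {_ , t′} eq with Σ-≡,≡←≡ eq
  ... | refl , eqt = cong (j ,_) (map-injective (↑ʳ-injective m _ _) t t′ eqt)

  shiftEDBs-hold : (f : Fin N → A) (es : List SA.EDBAtom) →
                   All (holdsEDB f) (List.map shiftEDB es) → All (SA.holdsEDB (f ∘ shift)) es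
  shiftEDBs-hold f es hs =
    All.map (λ {e} h → subst (rel 𝔸 (proj₁ e)) (sym (map-∘ f shift (proj₂ e))) h) (All-map⁻ hs)

  shiftEDBs-derived : (γ : Vec V m) (w : Fin r → V) (es : List SA.EDBAtom) →
                      All (RA.EDBDerived w) es → All (EDBDerived (glue γ w)) (List.map shiftEDB es)
  shiftEDBs-derived γ w es ds =
    All-map⁺ (All.map (λ {e} d → subst (λ z → (proj₁ e , z) ∈ C) (sym (glue-shift γ w (proj₂ e))) d) ds)

  liftLink : (P : Vec A m → Set) (rl : SA.Rule) {mb : Maybe SA.IDBAtom} → SA.bodyIDB rl ≡ mb →
             Link (pairAtom P (SA.head rl)) (bodyAtom P mb)
  liftLink P rl {mb} eq = record
    { basics   = List.map shiftEDB (SA.edbs rl)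
    ; small    = All-map⁺ (All.map (λ p → ≤-trans p (m≤n+m r m)) (SA.edbs-small rl))
    ; unique   = Unique-map⁺ shiftEDB-injective (SA.edbs-unique rl)
    ; forward  = λ f hs hb → let (p , body) = bodyAtom-split f P mb hb in
        pairAtom-join f P (SA.head rl) p
          (SA.consistent rl (f ∘ shift) (shiftEDBs-hold f _ hs)
            (subst (SA.holdsBody (f ∘ shift)) (sym eq) body))
    ; backward = λ f hs hh → let (p , hd) = pairAtom-split f P (SA.head rl) hh in
        bodyAtom-join f P mb p
          (subst (SA.holdsBody (f ∘ shift)) eq (recover-body rl (f ∘ shift) (shiftEDBs-hold f _ hs) hd))
    }

  extend : {l : ℕ} {Q : Vec A l → Set} {q : Vec V l} → RA.Derives Q q →
           (P : Vec A m → Set) {γ : Vec V m} → Derives P γ → Derives (P ⊗ Q) (γ ++ q)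
  extend (RA.by₀ rl w eq ed) P {γ} dP =
    follow (liftLink P rl eq) (glue γ w) (shiftEDBs-derived γ w _ ed)
      (glue-ctx γ w) (pairAtom-at P (SA.head rl) γ w) dP
  extend (RA.by₁ rl w a eq ed d) P {γ} dP =
    follow (liftLink P rl eq) (glue γ w) (shiftEDBs-derived γ w _ ed)
      (pairAtom-at P a γ w) (pairAtom-at P (SA.head rl) γ w) (extend d P dP)

  retract : {l : ℕ} {Q : Vec A l → Set} {q : Vec V l} → RA.Derives Q q →
            (P : Vec A m → Set) {γ : Vec V m} → Derives (P ⊗ Q) (γ ++ q) → Derives P γ
  retract (RA.by₀ rl w eq ed) P {γ} dPQ =
    follow (reverse (liftLink P rl eq)) (glue γ w) (shiftEDBs-derived γ w _ ed)
      (pairAtom-at P (SA.head rl) γ w) (glue-ctx γ w) dPQ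
  retract (RA.by₁ rl w a eq ed d) P {γ} dPQ =
    retract d P (follow (reverse (liftLink P rl eq)) (glue γ w) (shiftEDBs-derived γ w _ ed)
      (pairAtom-at P (SA.head rl) γ w) (pairAtom-at P a γ w) dPQ)

module Simulation {A : Set} (𝔸 : Structure A) (r : ℕ) {V : Set} (C : List (Constraint 𝔸 V))
                  (k : ℕ) (𝔹 : Structure (Vec A k)) (s : ℕ) (CJ : List (Constraint 𝔹 (Vec V k)))
                  (basic-derivable : (c : Constraint 𝔹 (Vec V k)) → c ∈ CJ →
                     Derivable 𝔸 C r (unpack (rel 𝔹 (proj₁ c))) (concat (proj₂ c)))
                  (v₀ : V) where

  open Context 𝔸 r C (s * k)
  open Symmetric 𝔸 N
  open Run C
  open Facts 𝔸 r C using () renaming (arity-bound to arity≤r)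
  open Facts 𝔹 s CJ using (recover-body)
  module SB = Symmetric 𝔹 s
  module RB = SB.Run CJ

  decode : {Z : Set} → Vec Z (s * k) → Fin s → Vec Z k
  decode v b = tabulate (λ i → lookup v (combine b i))

  decode-map : {Y Z : Set} (g : Y → Z) (v : Vec Y (s * k)) (b : Fin s) →
               map g (decode v b) ≡ decode (map g v) b
  decode-map g v b = begin
    map g (tabulate (λ i → lookup v (combine b i)))  ≡⟨ tabulate-∘ g _ ⟨
    tabulate (λ i → g (lookup v (combine b i)))      ≡⟨ tabulate-cong (λ i → lookup-map (combine b i) g v) ⟨
    decode (map g v) b                               ∎
    where open ≡-Reasoning

  decode-concat : {Z : Set} (ω : Fin s → Vec Z k) (b : Fin s) → decode (concat (tabulate ω)) b ≡ ω b
  decode-concat ω b = begin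
    tabulate (λ i → lookup (concat (tabulate ω)) (combine b i))  ≡⟨ tabulate-cong (lookup-concat (tabulate ω) b) ⟩
    tabulate (lookup (lookup (tabulate ω) b))                    ≡⟨ cong (tabulate ∘ lookup) (lookup∘tabulate ω b) ⟩
    tabulate (lookup (ω b))                                      ≡⟨ tabulate∘lookup (ω b) ⟩
    ω b                                                          ∎
    where open ≡-Reasoning

  blocks : {l : ℕ} → Vec (Fin s) l → Vec (Fin N) (l * k)
  blocks t = concat (map (decode ctx) t)

  blocks-map : {Z : Set} (g : Fin N → Z) {l : ℕ} (t : Vec (Fin s) l) →
               map g (blocks t) ≡ concat (map (decode (map g ctx)) t)
  blocks-map g t = begin
    map g (concat (map (decode ctx) t))            ≡⟨ map-concat g (map (decode ctx) t) ⟩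
    concat (map (map g) (map (decode ctx) t))      ≡⟨ cong concat (map-∘ (map g) (decode ctx) t) ⟨
    concat (map (map g ∘ decode ctx) t)            ≡⟨ cong concat (map-cong (decode-map g ctx) t) ⟩
    concat (map (decode (map g ctx)) t)            ∎
    where open ≡-Reasoning

  unpack-blocks→ : (f : Fin N → A) {l : ℕ} (H : Vec (Vec A k) l → Set) (t : Vec (Fin s) l) →
                   unpack H (map f (blocks t)) → H (map (decode (map f ctx)) t)
  unpack-blocks→ f H t h = unpack-concat _ (subst (unpack H) (blocks-map f t) h)

  unpack-blocks← : (f : Fin N → A) {l : ℕ} (H : Vec (Vec A k) l → Set) (t : Vec (Fin s) l) →
                   H (map (decode (map f ctx)) t) → unpack H (map f (blocks t))
  unpack-blocks← f H t h = subst (unpack H) (sym (blocks-map f t)) (_ , refl , h)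

  context : (Fin s → Vec V k) → Vec V (s * k)
  context ωB = concat (tabulate ωB)

  encode : (Fin s → Vec V k) → Fin N → V
  encode ωB = glue (context ωB) (λ _ → v₀)

  encode-ctx : (ωB : Fin s → Vec V k) → map (encode ωB) ctx ≡ context ωB
  encode-ctx ωB = glue-ctx (context ωB) (λ _ → v₀)

  encode-blocks : (ωB : Fin s → Vec V k) {l : ℕ} (t : Vec (Fin s) l) →
                  map (encode ωB) (blocks t) ≡ concat (map ωB t)
  encode-blocks ωB t = begin
    map (encode ωB) (blocks t)                     ≡⟨ blocks-map (encode ωB) t ⟩
    concat (map (decode (map (encode ωB) ctx)) t)  ≡⟨ cong (λ γ → concat (map (decode γ) t)) (encode-ctx ωB) ⟩
    concat (map (decode (context ωB)) t)           ≡⟨ cong concat (map-cong (decode-concat ωB) t) ⟩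
    concat (map ωB t)                              ∎
    where open ≡-Reasoning

  convert : (ωB : Fin s → Vec V k) {P P′ : Vec A (s * k) → Set} →
            (∀ v → P v → P′ v) → (∀ v → P′ v → P v) →
            Derives P (context ωB) → Derives P′ (context ωB)
  convert ωB {P} {P′} P⇒P′ P′⇒P =
    follow (equivalence (ctxAtom P′) (ctxAtom P) (λ f → P⇒P′ _) (λ f → P′⇒P _))
      (encode ωB) [] (encode-ctx ωB) (encode-ctx ωB)

  trivial : (ωB : Fin s → Vec V k) → Derives (λ _ → ⊤) (context ωB)
  trivial ωB = axiom (ctxAtom (λ _ → ⊤)) (λ _ → tt) (encode ωB) (encode-ctx ωB)

  Holds : SB.IDBAtom → Vec A (s * k) → Set
  Holds a v = SB.holdsIDB (decode v) a

  unpackedAtom : SB.IDBAtom → IDBAtom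
  unpackedAtom a = idb (SB.n a * k) (≤-trans (*-monoˡ-≤ k (SB.n≤r a)) (m≤m+n (s * k) r))
                       (unpack (SB.R a)) (blocks (SB.tuple a))

  unpackLink : (a : SB.IDBAtom) → Link (ctxAtom (Holds a)) (unpackedAtom a)
  unpackLink a = equivalence (ctxAtom (Holds a)) (unpackedAtom a)
    (λ f → unpack-blocks→ f (SB.R a) (SB.tuple a)) (λ f → unpack-blocks← f (SB.R a) (SB.tuple a))

  unpacked→Holds : (ωB : Fin s → Vec V k) (a : SB.IDBAtom) →
                   Derives (unpack (SB.R a)) (concat (map ωB (SB.tuple a))) → Derives (Holds a) (context ωB)
  unpacked→Holds ωB a =
    follow (unpackLink a) (encode ωB) [] (encode-blocks ωB (SB.tuple a)) (encode-ctx ωB)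

  Holds→unpacked : (ωB : Fin s → Vec V k) (a : SB.IDBAtom) →
                   Derives (Holds a) (context ωB) → Derives (unpack (SB.R a)) (concat (map ωB (SB.tuple a)))
  Holds→unpacked ωB a =
    follow (reverse (unpackLink a)) (encode ωB) [] (encode-ctx ωB) (encode-blocks ωB (SB.tuple a))

  _∧_ : (Vec A (s * k) → Set) → SB.EDBAtom → Vec A (s * k) → Set
  (P ∧ e) v = P v × SB.holdsEDB (decode v) e

  basicLink : (P : Vec A (s * k) → Set) (e : SB.EDBAtom) (le : arity 𝔹 (proj₁ e) * k ≤ r) →
              Link (ctxAtom (P ∧ e)) (ctxPair P (unpack (rel 𝔹 (proj₁ e))) le (blocks (proj₂ e)))
  basicLink P (j , t) le = equivalence _ _
    (λ f hp → let (p , u) = ctxPair-split f P (unpack (rel 𝔹 j)) le (blocks t) hp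
              in p , unpack-blocks→ f (rel 𝔹 j) t u)
    (λ f (p , h) → ctxPair-join f P (unpack (rel 𝔹 j)) le (blocks t) p (unpack-blocks← f (rel 𝔹 j) t h))

  encode-ctx++blocks : (ωB : Fin s → Vec V k) {l : ℕ} (t : Vec (Fin s) l) →
                       map (encode ωB) (ctx ++ blocks t) ≡ context ωB ++ concat (map ωB t)
  encode-ctx++blocks ωB t =
    trans (map-++ (encode ωB) ctx (blocks t)) (cong₂ _++_ (encode-ctx ωB) (encode-blocks ωB t))

  -- Adding or removing a basic atom e = (j , t) of a fired rule: e is a constraint
  -- of J, so unpack(j) is derivable on its variables in S^r_𝔸 (hypothesis (1)),
  -- and context extension applies.

  addBasic : (ωB : Fin s → Vec V k) (e : SB.EDBAtom) → RB.EDBDerived ωB e → (P : Vec A (s * k) → Set) →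
             Derives P (context ωB) → Derives (P ∧ e) (context ωB)
  addBasic ωB (j , t) e∈J P dP =
    follow (basicLink P (j , t) (arity≤r dj)) (encode ωB) [] (encode-ctx++blocks ωB t) (encode-ctx ωB)
      (extend dj P dP)
    where
      dj : RA.Derives (unpack (rel 𝔹 j)) (concat (map ωB t))
      dj = basic-derivable (j , map ωB t) e∈J

  removeBasic : (ωB : Fin s → Vec V k) (e : SB.EDBAtom) → RB.EDBDerived ωB e → (P : Vec A (s * k) → Set) →
                Derives (P ∧ e) (context ωB) → Derives P (context ωB)
  removeBasic ωB (j , t) e∈J P dPe =
    retract dj P
      (follow (reverse (basicLink P (j , t) (arity≤r dj))) (encode ωB) []
        (encode-ctx ωB) (encode-ctx++blocks ωB t) dPe)
    where
      dj : RA.Derives (unpack (rel 𝔹 j)) (concat (map ωB t))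
      dj = basic-derivable (j , map ωB t) e∈J

  With : (Vec A (s * k) → Set) → List SB.EDBAtom → Vec A (s * k) → Set
  With P es v = P v × All (SB.holdsEDB (decode v)) es

  addBasics : (ωB : Fin s → Vec V k) (es : List SB.EDBAtom) → All (RB.EDBDerived ωB) es →
              (P : Vec A (s * k) → Set) → Derives P (context ωB) → Derives (With P es) (context ωB)
  addBasics ωB List.[] [] P dP = convert ωB (λ _ p → p , []) (λ _ → proj₁) dP
  addBasics ωB (e List.∷ es) (e∈J ∷ es∈J) P dP =
    convert ωB (λ { _ ((p , hs) , h) → p , h ∷ hs }) (λ { _ (p , h ∷ hs) → (p , hs) , h })
      (addBasic ωB e e∈J (With P es) (addBasics ωB es es∈J P dP))

  removeBasics : (ωB : Fin s → Vec V k) (es : List SB.EDBAtom) → All (RB.EDBDerived ωB) es →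
                 (P : Vec A (s * k) → Set) → Derives (With P es) (context ωB) → Derives P (context ωB)
  removeBasics ωB List.[] [] P dP = convert ωB (λ _ → proj₁) (λ _ p → p , []) dP
  removeBasics ωB (e List.∷ es) (e∈J ∷ es∈J) P dP =
    removeBasics ωB es es∈J P (removeBasic ωB e e∈J (With P es)
      (convert ωB (λ { _ (p , h ∷ hs) → (p , hs) , h }) (λ { _ ((p , hs) , h) → p , h ∷ hs }) dP))

  Body : Maybe SB.IDBAtom → Vec A (s * k) → Set
  Body mb v = SB.holdsBody (decode v) mb

  -- Firing a rule of S^s_𝔹: add its basic atoms to the body, exchange body for
  -- head (consistency and symmetry of the rule), remove the basic atoms, unpack.
  fire : (rl : SB.Rule) (ωB : Fin s → Vec V k) → All (RB.EDBDerived ωB) (SB.edbs rl) →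
         Derives (Body (SB.bodyIDB rl)) (context ωB) →
         Derives (unpack (SB.R (SB.head rl))) (concat (map ωB (SB.tuple (SB.head rl))))
  fire rl ωB es∈J dBody =
    Holds→unpacked ωB (SB.head rl) (removeBasics ωB (SB.edbs rl) es∈J (Holds (SB.head rl))
      (convert ωB (λ v (b , hs) → SB.consistent rl (decode v) hs b , hs)
                  (λ v (h , hs) → recover-body rl (decode v) hs h , hs)
        (addBasics ωB (SB.edbs rl) es∈J (Body (SB.bodyIDB rl)) dBody)))

  simulate : {l : ℕ} {S : Vec (Vec A k) l → Set} {ρ : Vec (Vec V k) l} →
             RB.Derives S ρ → Derives (unpack S) (concat ρ)
  simulate (RB.by₀ rl ωB eq es∈J) =
    fire rl ωB es∈J (subst (λ mb → Derives (Body mb) (context ωB)) (sym eq) (trivial ωB))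
  simulate (RB.by₁ rl ωB a eq es∈J d) =
    fire rl ωB es∈J
      (subst (λ mb → Derives (Body mb) (context ωB)) (sym eq) (unpacked→Holds ωB a (simulate d)))

-- The simulation fills the scratch area with an arbitrary variable of I; one
-- exists, since otherwise J would be a satisfiable instance deriving an empty goal.
someVariable : (k : ℕ) {A : Set} (𝔸 : Structure A) (𝔹 : Structure (Vec A k))
               {V : Set} (C : List (Constraint 𝔸 V)) (CJ : List (Constraint 𝔹 (Vec V k)))
               (r s : ℕ) → 1 ≤ r → 1 ≤ s →
               ((c : Constraint 𝔹 (Vec V k)) → c ∈ CJ →
                 Derivable 𝔸 C r (unpack (rel 𝔹 (proj₁ c))) (concat (proj₂ c))) →
               {l : ℕ} {G : Vec (Vec A k) l → Set} {ρ : Vec (Vec V k) l} →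
               (∀ t → ¬ G t) → Derivable 𝔹 CJ s G ρ → V
someVariable (suc k) 𝔸 𝔹 C CJ r s _ 1≤s _ _ dG =
  Data.Vec.head (Facts.valuation 𝔹 s CJ dG (fromℕ< 1≤s))
someVariable zero 𝔸 𝔹 C (c List.∷ CJ) r s 1≤r _ basic-derivable _ _ =
  Facts.valuation 𝔸 r C (basic-derivable c (here refl)) (fromℕ< 1≤r)
someVariable zero 𝔸 𝔹 C List.[] r s _ _ _ G-empty dG =
  ⊥-elim (G-empty _ (Facts.sound 𝔹 s List.[] {h = λ _ → []} (λ ()) dG))

lemma11 : (k : ℕ) {A : Set} → Finite A → (𝔸 : Structure A) (𝔹 : Structure (Vec A k))
    {V : Set} → Finite V → (C : List (Constraint 𝔸 V))
    (CJ : List (Constraint 𝔹 (Vec V k)))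
    (r s : ℕ) → 1 ≤ r → 1 ≤ s →
    ((c : Constraint 𝔹 (Vec V k)) → c ∈ CJ →
    Derivable 𝔸 C r (unpack (rel 𝔹 (proj₁ c))) (concat (proj₂ c))) →
    GoalDerived 𝔹 CJ s →
    GoalDerived 𝔸 C (r + k * s)
lemma11 k _ 𝔸 𝔹 {V} _ C CJ r s 1≤r 1≤s basic-derivable (l , G , ρ , l≤s , G-empty , dG) =
  subst (GoalDerived 𝔸 C) N≡r+k*s
    (l * k , unpack G , concat ρ , lk≤N , unpack-empty , simulate dG)
  where
    v₀ : V
    v₀ = someVariable k 𝔸 𝔹 C CJ r s 1≤r 1≤s basic-derivable G-empty dG
    open Simulation 𝔸 r C k 𝔹 s CJ basic-derivable v₀ using (simulate)

    lk≤N : l * k ≤ s * k + r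
    lk≤N = ≤-trans (*-monoˡ-≤ k l≤s) (m≤m+n (s * k) r)

    unpack-empty : ∀ t → ¬ unpack G t
    unpack-empty _ (u , _ , g) = G-empty u g

    N≡r+k*s : s * k + r ≡ r + k * s
    N≡r+k*s = trans (+-comm (s * k) r) (cong (r +_) (*-comm s k))
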